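{- For every locally consistent maximal P2P system $PS$, the set $MaxWM(PS)$ of maximal weak models of $PS$ is nonempty.
   Context: Fix finite sets of predicate symbols, constants and variables; a term is a constant or a variable. A peer identifier is a positive integer. A (peer) atom has the form $i{:}p(t_1,\dots,t_k)$; a literal is an atom $A$ or $\mathit{not}\ A$ (negation as failure); a built-in atom is $X\,\theta\,Y$, $\theta\in\{<,>,\le,\ge,=,\ne\}$. Rules: (1) standard rules $H\leftarrow\mathcal B$ with $H=i{:}h(X)$ and $\mathcal B=j{:}p_1(X_1),\dots,j{:}p_m(X_m),\mathit{not}\ j{:}p_{m+1}(X_{m+1}),\dots,\mathit{not}\ j{:}p_n(X_n),\varphi$ ($\varphi$ a conjunction of built-in atoms); (2) integrity constraints $\leftarrow\mathcal B$ with $\mathcal B$ of that form over a single identifier $i$; (3) maximal mapping rules $H\leftharpoonup\mathcal B$, $H=i{:}h(X)$, $\mathcal B=j{:}p_1(X_1),\dots,j{:}p_m(X_m),\varphi$, $i\ne j$; (4) minimal mapping rules $H\leftharpoondown\mathcal B$ of the same shape. Rules are safe. A peer is $P_i=\langle D_i,LP_i,MP_i,IC_i\rangle$: $D_i$ ground atoms with identifier $i$, $LP_i$ standard rules with head and body identifier $i$, $MP_i$ mapping rules with head identifier $i$, $IC_i$ integrity constraints with identifier $i$. A P2P system is $PS=\{P_1,\dots,P_n\}$ with all identifiers in mapping rule bodies in $\{1,\dots,n\}$; $D,LP,MP,IC$ are the unions and $PS$ is identified with $D\cup LP\cup MP\cup IC$. It is maximal if all its mapping rules are maximal mapping rules.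 Mapping predicates are those occurring in heads of mapping rules; each is the head predicate of exactly one mapping rule. For an interpretation (set of ground atoms) $M$, $M[MP]$ is the set of atoms of $M$ with a mapping predicate. $St(r)=H\leftarrow\mathcal B$ for a mapping rule $r$ with head $H$ and body $\mathcal B$; $St(Q)$ replaces each mapping rule of $Q$ by $St(r)$. Truth in $M$: a ground conjunction is true if its positive atoms are in $M$, negated atoms are not, built-ins hold; a ground standard rule is true if body false or head in $M$; a ground constraint is true if body false. $MM(Q)$ = inclusion-minimal models. Stable models: for a program $Q$ of facts, standard rules and constraints, $M$ is stable if $M$ is the unique minimal model of the reduct $Q^M$ obtained from $ground(Q)$ by removing rules with a body literal $\mathit{not}\ A$, $A\in M$, and deleting negative literals from the rest; $SM(Q)$ is the set of stable models. Peer $P_i$ is locally consistent if $SM(D_i\cup LP_i\cup IC_i)\neq\emptyset$; a P2P system is locally consistent if all its peers are. $M$ is a weak model of $PS$ if $\{M\}=MM(St(PS^M))$, where $PS^M$ is obtained from $ground(PS)$ by removing every standard rule or constraint with a body literal $\mathit{not}\ A$, $A\in M$, deleting negative literals from the remaining ones, and removing every ground mapping rule whose head is not in $M$. For weak models, $M\sqsupseteq_{Max}N$ iff $M[MP]\supseteq N[MP]$, and $M\sqsupset_{Max}N$ iff $M\sqsupseteq_{Max}N$ and not $N\sqsupseteq_{Max}M$. A weak model $M$ is maximal if no weak model $N$ satisfies $N\sqsupset_{Max}M$; $MaxWM(PS)$ is the set of maximal weak models. -}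

module Defs where

open import Data.Nat using (ℕ; _<_; _≤_; _>_; _≥_)
open import Data.Fin using (Fin; toℕ)
open import Data.Vec using (Vec)
import Data.Vec as Vec
open import Data.Vec.Membership.Propositional using () renaming (_∈_ to _∈ᵥ_)
open import Data.List using (List; []; concatMap; allFin)
open import Data.List.Membership.Propositional using (_∈_)
open import Data.List.Relation.Unary.All using (All)
open import Data.List.Relation.Unary.Any using (Any)
open import Data.Bool using (Bool; true; false)
open import Data.Product using (Σ; ∃; _×_; _,_)
open import Data.Sum using (_⊎_)
open import Data.Empty using (⊥)
open import Relation.Binary.PropositionalEquality using (_≡_; _≢_)
open import Relation.Nullary using (¬_)

record Sig : Set where
  field
    nPred  : ℕ
    nConst : ℕ
    nVar   : ℕ
    arity  : Fin nPred → ℕ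

-- Everything is relative to a signature S and to the number n of peers.
-- Peer identifiers 1..n are represented by Fin n (index k ↔ identifier k+1).

module Core (S : Sig) (n : ℕ) where
  open Sig S

  Pred   = Fin nPred
  Const  = Fin nConst
  Var    = Fin nVar
  PeerId = Fin n

  data Term : Set where
    con : Const → Term
    var : Var → Term

  record LAtom : Set where
    constructor _⟨_⟩
    field
      pred : Pred
      args : Vec Term (arity pred)

  record Atom : Set where
    constructor _∶_
    field
      peer : PeerId
      atom : LAtom

  data Cmp : Set where
    lt gt le ge eq ne : Cmp

  record BuiltIn : Set where
    constructor bi
    field
      lhs : Term
      op  : Cmp
      rhs : Term

  record Body : Set where
    field
      bpeer    : PeerId
      pos      : List LAtom
      neg      : List LAtom
      builtins : List BuiltIn

  record StdRule : Set where
    field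
      head : Atom
      body : Body

  record Constraint : Set where
    field
      body : Body

  data MapKind : Set where
    maxMap minMap : MapKind

  -- H ⇀ B (maxMap) or H ⇁ B (minMap); the body has no negation
  record MapRule : Set where
    field
      kind     : MapKind
      head     : Atom
      bpeer    : PeerId
      pos      : List LAtom
      builtins : List BuiltIn

  record GAtom : Set where
    constructor gatom
    field
      gpeer : PeerId
      gpred : Pred
      gargs : Vec Const (arity gpred)

  record Program : Set where
    field
      D  : List GAtom
      LP : List StdRule
      MP : List MapRule
      IC : List Constraint

  open LAtom
  open Atom
  open BuiltIn
  open Body
  open StdRule
  open Constraint
  open MapRule
  open GAtom
  open Program

  OccL : Var → LAtom → Set
  OccL x a = var x ∈ᵥ args a

  OccB : Var → BuiltIn → Set
  OccB x b = (lhs b ≡ var x) ⊎ (rhs b ≡ var x)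

  SafeStd : StdRule → Set
  SafeStd r = ∀ x → (OccL x (atom (head r)) ⊎ Any (OccL x) (neg (body r))
                      ⊎ Any (OccB x) (builtins (body r)))
                  → Any (OccL x) (pos (body r))

  SafeCon : Constraint → Set
  SafeCon c = ∀ x → (Any (OccL x) (neg (body c)) ⊎ Any (OccB x) (builtins (body c)))
                  → Any (OccL x) (pos (body c))

  SafeMap : MapRule → Set
  SafeMap m = ∀ x → (OccL x (atom (head m)) ⊎ Any (OccB x) (builtins m))
                  → Any (OccL x) (pos m)

  System : Set
  System = PeerId → Program

  WellFormedPeer : PeerId → Program → Set
  WellFormedPeer i P =
      All (λ a → gpeer a ≡ i) (D P)
    × All (λ r → peer (head r) ≡ i × bpeer (body r) ≡ i × SafeStd r) (LP P)
    × All (λ m → peer (head m) ≡ i × bpeer m ≢ i × SafeMap m) (MP P)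
    × All (λ c → bpeer (body c) ≡ i × SafeCon c) (IC P)

  union : System → Program
  union PS = record
    { D  = concatMap (λ i → D  (PS i)) (allFin n)
    ; LP = concatMap (λ i → LP (PS i)) (allFin n)
    ; MP = concatMap (λ i → MP (PS i)) (allFin n)
    ; IC = concatMap (λ i → IC (PS i)) (allFin n)
    }

  IsMappingPred : System → PeerId → Pred → Set
  IsMappingPred PS i p = Any (λ m → peer (head m) ≡ i × pred (atom (head m)) ≡ p) (MP (union PS))

  UniqueMappingHeads : System → Set
  UniqueMappingHeads PS = ∀ m m' → m ∈ MP (union PS) → m' ∈ MP (union PS)
    → peer (head m) ≡ peer (head m') → pred (atom (head m)) ≡ pred (atom (head m'))
    → m ≡ m'

  WellFormedSystem : System → Set
  WellFormedSystem PS = (∀ i → WellFormedPeer i (PS i)) × UniqueMappingHeads PS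

  MaximalSystem : System → Set
  MaximalSystem PS = ∀ i → All (λ m → kind m ≡ maxMap) (MP (PS i))

  record GBuiltIn : Set where
    constructor gbi
    field
      glhs : Const
      gop  : Cmp
      grhs : Const

  record GBody : Set where
    field
      gpos : List GAtom
      gneg : List GAtom
      gbis : List GBuiltIn

  record GStd : Set where
    field
      ghead : GAtom
      gbody : GBody

  record GMap : Set where
    field
      gkind  : MapKind
      gmhead : GAtom
      gmpos  : List GAtom
      gmbis  : List GBuiltIn

  record GProg : Set₁ where
    field
      facts : GAtom → Set
      std   : GStd → Set
      cons  : GBody → Set
      maps  : GMap → Set

  open GBuiltIn
  open GBody
  open GStd
  open GMap
  open GProg

  Subst : Set
  Subst = Var → Const

  instT : Subst → Term → Const
  instT σ (con c) = c
  instT σ (var x) = σ x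

  instA : Subst → PeerId → LAtom → GAtom
  instA σ i (p ⟨ ts ⟩) = gatom i p (Vec.map (instT σ) ts)

  instBI : Subst → BuiltIn → GBuiltIn
  instBI σ (bi l o r) = gbi (instT σ l) o (instT σ r)

  instBody : Subst → Body → GBody
  instBody σ b = record
    { gpos = Data.List.map (instA σ (bpeer b)) (pos b)
    ; gneg = Data.List.map (instA σ (bpeer b)) (neg b)
    ; gbis = Data.List.map (instBI σ) (builtins b)
    }

  instStd : Subst → StdRule → GStd
  instStd σ r = record
    { ghead = instA σ (peer (head r)) (atom (head r))
    ; gbody = instBody σ (body r) }

  instMap : Subst → MapRule → GMap
  instMap σ m = record
    { gkind  = kind m
    ; gmhead = instA σ (peer (head m)) (atom (head m))
    ; gmpos  = Data.List.map (instA σ (bpeer m)) (pos m)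
    ; gmbis  = Data.List.map (instBI σ) (builtins m) }

  ground : Program → GProg
  ground Q = record
    { facts = λ a → a ∈ D Q
    ; std   = λ g → Σ StdRule λ r → Σ Subst λ σ → r ∈ LP Q × instStd σ r ≡ g
    ; cons  = λ g → Σ Constraint λ c → Σ Subst λ σ → c ∈ IC Q × instBody σ (body c) ≡ g
    ; maps  = λ g → Σ MapRule λ m → Σ Subst λ σ → m ∈ MP Q × instMap σ m ≡ g
    }

  Interp : Set
  Interp = GAtom → Bool

  _∈I_ : GAtom → Interp → Set
  a ∈I M = M a ≡ true

  _∉I_ : GAtom → Interp → Set
  a ∉I M = M a ≡ false

  _⊆I_ : Interp → Interp → Set
  N ⊆I M = ∀ a → a ∈I N → a ∈I M

  dropNeg : GBody → GBody
  dropNeg b = record b { gneg = [] }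

  reduct : Interp → GProg → GProg
  reduct M Q = record
    { facts = facts Q
    ; std   = λ g → Σ GStd λ g₀ → std Q g₀ × All (_∉I M) (gneg (gbody g₀))
                      × g ≡ record g₀ { gbody = dropNeg (gbody g₀) }
    ; cons  = λ g → Σ GBody λ g₀ → cons Q g₀ × All (_∉I M) (gneg g₀) × g ≡ dropNeg g₀
    ; maps  = λ g → maps Q g × gmhead g ∈I M
    }

  StMap : GMap → GStd
  StMap m = record
    { ghead = gmhead m
    ; gbody = record { gpos = gmpos m ; gneg = [] ; gbis = gmbis m } }

  St : GProg → GProg
  St Q = record
    { facts = facts Q
    ; std   = λ g → std Q g ⊎ Σ GMap λ m → maps Q m × g ≡ StMap m
    ; cons  = cons Q
    ; maps  = λ _ → ⊥
    }

  evalCmp : Cmp → Const → Const → Set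
  evalCmp lt c d = toℕ c < toℕ d
  evalCmp gt c d = toℕ c > toℕ d
  evalCmp le c d = toℕ c ≤ toℕ d
  evalCmp ge c d = toℕ c ≥ toℕ d
  evalCmp eq c d = c ≡ d
  evalCmp ne c d = c ≢ d

  BuiltInTrue : GBuiltIn → Set
  BuiltInTrue b = evalCmp (gop b) (glhs b) (grhs b)

  BodyTrue : Interp → GBody → Set
  BodyTrue M b = All (_∈I M) (gpos b) × All (_∉I M) (gneg b) × All BuiltInTrue (gbis b)

  -- M is a model of a ground program made of facts, standard rules and
  -- constraints (the only programs to which models are applied below)
  IsModel : GProg → Interp → Set
  IsModel Q M =
      (∀ a → facts Q a → a ∈I M)
    × (∀ g → std Q g → BodyTrue M (gbody g) → ghead g ∈I M)
    × (∀ b → cons Q b → ¬ BodyTrue M b)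

  IsMinModel : GProg → Interp → Set
  IsMinModel Q M = IsModel Q M × (∀ N → IsModel Q N → N ⊆I M → M ⊆I N)

  UniqueMinModel : GProg → Interp → Set
  UniqueMinModel Q M = IsMinModel Q M × (∀ N → IsMinModel Q N → N ⊆I M × M ⊆I N)

  localProgram : Program → Program
  localProgram P = record P { MP = [] }

  IsStable : Program → Interp → Set
  IsStable Q M = UniqueMinModel (reduct M (ground Q)) M

  LocallyConsistentPeer : Program → Set
  LocallyConsistentPeer P = ∃ λ M → IsStable (localProgram P) M

  LocallyConsistent : System → Set
  LocallyConsistent PS = ∀ i → LocallyConsistentPeer (PS i)

  IsWeakModel : System → Interp → Set
  IsWeakModel PS M = UniqueMinModel (St (reduct M (ground (union PS)))) M

  IsMappingAtom : System → GAtom → Set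
  IsMappingAtom PS a = IsMappingPred PS (gpeer a) (gpred a)

  _⊒Max_within_ : Interp → Interp → System → Set
  M ⊒Max N within PS = ∀ a → IsMappingAtom PS a → a ∈I N → a ∈I M

  _⊐Max_within_ : Interp → Interp → System → Set
  M ⊐Max N within PS = (M ⊒Max N within PS) × ¬ (N ⊒Max M within PS)

  IsMaxWeakModel : System → Interp → Set
  IsMaxWeakModel PS M =
    IsWeakModel PS M × (∀ N → IsWeakModel PS N → ¬ (N ⊐Max M within PS))

open Core public

-- Each peer i has a stable model Mᵢ of its local program; glue them into M, reading the atoms
-- of peer i off Mᵢ. Local rules and constraints of peer i mention only peer i, so M satisfies
-- them, and a ground mapping rule survives in PS^M only when its head is already in M, so M is
-- a model of St(PS^M). It is minimal peer by peer: a model N ⊆ M, completed by Mᵢ outside peer i,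
-- is a model of the local reduct below Mᵢ and hence contains Mᵢ. Once the reduct is fixed the
-- program is Horn, so its minimal model is unique and M is a weak model.
-- There are finitely many ground atoms, substitutions and interpretations, so being a weak
-- model and ⊐Max are decidable. Moving to a ⊐Max-larger weak model strictly increases the
-- number of true mapping atoms, which is bounded, so the search ends at a maximal weak model.

module Submission where

open import Level using (0ℓ)
open import Data.Bool using (Bool; true; false; _∧_; if_then_else_)
import Data.Bool.Properties as Bool
open import Data.Empty using (⊥-elim)
open import Data.Fin using (Fin; toℕ) renaming (_≟_ to _≟ᶠ_)
open import Data.List using (List; []; _∷_; [_]; map; concatMap; allFin; filter; length)
import Data.List.Properties as List
open import Data.List.Membership.Propositional using (_∈_; lose)
open import Data.List.Membership.Propositional.Properties
  using (∈-map⁺; ∈-concatMap⁺; ∈-concatMap⁻; ∈-allFin; ∈-filter⁺; ∈-filter⁻)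
open import Data.List.Relation.Unary.All using (All; []; _∷_; all?; zipWith)
  renaming (lookup to lookupᴬ; tabulate to tabulateᴬ; map to mapᴬ)
open import Data.List.Relation.Unary.Any using (here; there; satisfied; any?)
import Data.List.Relation.Binary.Pointwise as Pointwise
open import Data.List.Relation.Binary.Sublist.Heterogeneous using (Sublist)
open import Data.List.Relation.Binary.Sublist.Heterogeneous.Properties
  using (⊆-filter-Sublist; fromPointwise; toPointwise; length-mono-≤)
open import Data.Nat using (ℕ; zero; suc; _≤_; _<_; _∸_; _<?_; _≤?_)
open import Data.Nat.Induction using (<-wellFounded)
open import Data.Nat.Properties using (≤-antisym; ∸-monoʳ-<; ≰⇒>)
open import Data.Product using (∃; _×_; _,_; proj₁; proj₂)
open import Data.Sum using (inj₁; inj₂)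
open import Data.Vec using (Vec; []; _∷_; lookup; tabulate)
import Data.Vec.Properties as Vec
open import Function using (_∘_)
open import Function.Bundles using (_⇔_; mk⇔; Equivalence)
open import Induction.WellFounded using (Acc; acc)
open import Relation.Binary.Core using (Rel)
open import Relation.Binary.Definitions using (Symmetric; _Respects_; DecidableEquality)
open import Relation.Binary.PropositionalEquality using (_≡_; refl; sym; trans; subst; cong; cong₂; _≗_)
open import Relation.Nullary using (Dec; yes; no; does; ¬_)
open import Relation.Nullary.Decidable using (map′; _×-dec_; _→-dec_; ¬?) renaming (map to map-⇔)
open import Relation.Unary using (Decidable)
import Defs
open Defs using (Sig; module Core)

-- Functions can be listed only up to pointwise equality, hence completeness up to _≈_.
record Enumeration (A : Set) (_≈_ : Rel A 0ℓ) : Set where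
  field
    elements : List A
    complete : ∀ x → ∃ λ y → y ∈ elements × x ≈ y
    ≈-sym    : Symmetric _≈_

module _ {A : Set} {_≈_ : Rel A 0ℓ} (E : Enumeration A _≈_)
         {P : A → Set} (resp : P Respects _≈_) (P? : Decidable P) where
  open Enumeration E

  ∀? : Dec (∀ x → P x)
  ∀? = map′ (λ ps x → let y , y∈ , x≈y = complete x in resp (≈-sym x≈y) (lookupᴬ ps y∈))
            (λ ∀P → tabulateᴬ λ {y} _ → ∀P y)
            (all? P? elements)

  ∃? : Dec (∃ P)
  ∃? = map′ satisfied
            (λ (x , px) → let y , y∈ , x≈y = complete x in lose y∈ (resp x≈y px))
            (any? P? elements)

vectors : (m k : ℕ) → List (Vec (Fin m) k)
vectors m zero    = [ [] ]
vectors m (suc k) = concatMap (λ x → map (x ∷_) (vectors m k)) (allFin m)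

∈-vectors : ∀ {m k} (v : Vec (Fin m) k) → v ∈ vectors m k
∈-vectors []       = here refl
∈-vectors (x ∷ v) = ∈-concatMap⁺ _ (lose (∈-allFin x) (∈-map⁺ (x ∷_) (∈-vectors v)))

finFunctions : (k m : ℕ) → Enumeration (Fin k → Fin m) _≗_
finFunctions k m = record
  { elements = map lookup (vectors m k)
  ; complete = λ f → lookup (tabulate f) , ∈-map⁺ lookup (∈-vectors (tabulate f)) ,
                     λ x → sym (Vec.lookup∘tabulate f x)
  ; ≈-sym    = λ f≗g x → sym (f≗g x)
  }

module _ {A : Set} (_≟_ : DecidableEquality A) where

  update : A → Bool → (A → Bool) → (A → Bool)
  update a b f x = if does (x ≟ a) then b else f x

  predicatesOn : List A → List (A → Bool)
  predicatesOn []       = [ (λ _ → false) ]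
  predicatesOn (a ∷ as) = concatMap (λ f → update a true f ∷ update a false f ∷ []) (predicatesOn as)

  predicatesOn-complete : ∀ (g : A → Bool) as →
    ∃ λ f → f ∈ predicatesOn as × (∀ {x} → x ∈ as → g x ≡ f x)
  predicatesOn-complete g []       = _ , here refl , λ ()
  predicatesOn-complete g (a ∷ as) =
    let f , f∈ , g≈f = predicatesOn-complete g as in
    update a (g a) f , ∈-concatMap⁺ _ (lose f∈ (updated∈ (g a))) , agrees g≈f
    where
    updated∈ : ∀ {f} b → update a b f ∈ (update a true f ∷ update a false f ∷ [])
    updated∈ true  = here refl
    updated∈ false = there (here refl)
    agrees : ∀ {f} → (∀ {x} → x ∈ as → g x ≡ f x) → ∀ {x} → x ∈ a ∷ as → g x ≡ update a (g a) f x
    agrees g≈f {x} x∈ with x ≟ a | x∈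
    ... | yes refl | _         = refl
    ... | no  x≢a  | here x≡a  = ⊥-elim (x≢a x≡a)
    ... | no  _    | there x∈′ = g≈f x∈′

  predicates : (as : List A) → (∀ x → x ∈ as) → Enumeration (A → Bool) _≗_
  predicates as all∈ = record
    { elements = predicatesOn as
    ; complete = λ g → let f , f∈ , g≈f = predicatesOn-complete g as in f , f∈ , λ x → g≈f (all∈ x)
    ; ≈-sym    = λ f≗g x → sym (f≗g x)
    }

module _ {A : Set} {P Q : A → Set} (P? : Decidable P) (Q? : Decidable Q) (P⇒Q : ∀ {x} → P x → Q x) where

  filter-length-reflects : ∀ xs → length (filter Q? xs) ≤ length (filter P? xs) →
                           ∀ {x} → x ∈ xs → Q x → P x
  filter-length-reflects xs len≤ x∈ qx =
    proj₂ (∈-filter⁻ P? {xs = xs} (subst (_ ∈_) (sym same) (∈-filter⁺ Q? x∈ qx)))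
    where
    P⊆Q : Sublist _≡_ (filter P? xs) (filter Q? xs)
    P⊆Q = ⊆-filter-Sublist P? Q? {as = xs} (λ { refl → P⇒Q }) (fromPointwise (Pointwise.refl refl))
    same : filter P? xs ≡ filter Q? xs
    same = Pointwise.Pointwise-≡⇒≡ (toPointwise (≤-antisym (length-mono-≤ P⊆Q) len≤) P⊆Q)

module _ {A : Set} (P : A → Set) (_⊐_ : Rel A 0ℓ) (μ : A → ℕ) (bound : ℕ)
         (μ≤bound : ∀ x → μ x ≤ bound) (⊐⇒μ< : ∀ {x y} → y ⊐ x → μ x < μ y)
         (improvement? : ∀ x → Dec (∃ λ y → P y × y ⊐ x)) where

  maximal-element : ∃ P → ∃ λ m → P m × (∀ y → P y → ¬ y ⊐ m)
  maximal-element (x , px) = climb x px (<-wellFounded (bound ∸ μ x))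
    where
    climb : ∀ x → P x → Acc _<_ (bound ∸ μ x) → ∃ λ m → P m × (∀ y → P y → ¬ y ⊐ m)
    climb x px (acc rec) with improvement? x
    ... | no  stuck          = x , px , λ y py y⊐x → stuck (y , py , y⊐x)
    ... | yes (y , py , y⊐x) = climb y py (rec (∸-monoʳ-< (⊐⇒μ< y⊐x) (μ≤bound y)))

module _ (S : Sig) (n : ℕ) where
  open Sig S
  open Core S n
  open LAtom
  open Atom
  open Body
  open StdRule
  open Constraint
  open MapRule
  open GAtom
  open Program
  open GBuiltIn
  open GBody
  open GStd
  open GMap
  open GProg

  _≟ᴳ_ : DecidableEquality GAtom
  gatom i p xs ≟ᴳ gatom j q ys with i ≟ᶠ j | p ≟ᶠ q
  ... | no i≢j   | _        = no λ { refl → i≢j refl }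
  ... | yes _    | no p≢q   = no λ { refl → p≢q refl }
  ... | yes refl | yes refl with Vec.≡-dec _≟ᶠ_ xs ys
  ...   | yes refl  = yes refl
  ...   | no xs≢ys = no λ { refl → xs≢ys refl }

  groundAtoms : List GAtom
  groundAtoms = concatMap (λ i → concatMap (λ p → map (gatom i p) (vectors nConst (arity p)))
                                           (allFin nPred))
                          (allFin n)

  ∈-groundAtoms : ∀ a → a ∈ groundAtoms
  ∈-groundAtoms (gatom i p xs) =
    ∈-concatMap⁺ _ (lose (∈-allFin i)
      (∈-concatMap⁺ _ (lose (∈-allFin p) (∈-map⁺ (gatom i p) (∈-vectors xs)))))

  atoms : Enumeration GAtom _≡_
  atoms = record { elements = groundAtoms ; complete = λ a → a , ∈-groundAtoms a , refl ; ≈-sym = sym }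

  interpretations : Enumeration Interp _≗_
  interpretations = predicates _≟ᴳ_ groundAtoms ∈-groundAtoms

  substitutions : Enumeration Subst _≗_
  substitutions = finFunctions nVar nConst

  module _ {σ τ : Subst} (σ≗τ : σ ≗ τ) where

    instT-cong : ∀ t → instT σ t ≡ instT τ t
    instT-cong (con c) = refl
    instT-cong (var x) = σ≗τ x

    instA-cong : ∀ i l → instA σ i l ≡ instA τ i l
    instA-cong i (p ⟨ ts ⟩) = cong (gatom i p) (Vec.map-cong instT-cong ts)

    instBI-cong : ∀ b → instBI σ b ≡ instBI τ b
    instBI-cong (bi l o r) = cong₂ (λ x y → gbi x o y) (instT-cong l) (instT-cong r)

    instBody-cong : ∀ b → instBody σ b ≡ instBody τ b
    instBody-cong b =
      cong₂ (λ (ps , ns) bs → record { gpos = ps ; gneg = ns ; gbis = bs })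
            (cong₂ _,_ (List.map-cong (instA-cong (bpeer b)) (pos b))
                       (List.map-cong (instA-cong (bpeer b)) (neg b)))
            (List.map-cong instBI-cong (builtins b))

    instStd-cong : ∀ r → instStd σ r ≡ instStd τ r
    instStd-cong r = cong₂ (λ h b → record { ghead = h ; gbody = b })
                           (instA-cong (peer (head r)) (atom (head r))) (instBody-cong (body r))

    instMap-cong : ∀ m → instMap σ m ≡ instMap τ m
    instMap-cong m =
      cong₂ (λ h (ps , bs) → record { gkind = kind m ; gmhead = h ; gmpos = ps ; gmbis = bs })
            (instA-cong (peer (head m)) (atom (head m)))
            (cong₂ _,_ (List.map-cong (instA-cong (bpeer m)) (pos m))
                       (List.map-cong instBI-cong (builtins m)))

  -- Decidability of weak models

  _∈?_ : ∀ a X → Dec (a ∈I X)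
  a ∈? X = X a Bool.≟ true

  _∉?_ : ∀ a X → Dec (a ∉I X)
  a ∉? X = X a Bool.≟ false

  builtIn? : Decidable BuiltInTrue
  builtIn? (gbi c lt d) = toℕ c <? toℕ d
  builtIn? (gbi c gt d) = toℕ d <? toℕ c
  builtIn? (gbi c le d) = toℕ c ≤? toℕ d
  builtIn? (gbi c ge d) = toℕ d ≤? toℕ c
  builtIn? (gbi c eq d) = c ≟ᶠ d
  builtIn? (gbi c ne d) = ¬? (c ≟ᶠ d)

  bodyTrue? : ∀ X → Decidable (BodyTrue X)
  bodyTrue? X b = all? (_∈? X) (gpos b) ×-dec all? (_∉? X) (gneg b) ×-dec all? builtIn? (gbis b)

  _⊆?_ : ∀ X Y → Dec (X ⊆I Y)
  X ⊆? Y = ∀? atoms (λ { refl h → h }) (λ a → a ∈? X →-dec a ∈? Y)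

  All-≗ : ∀ {X Y : Interp} {b} → X ≗ Y → ∀ {as} → All (λ a → X a ≡ b) as → All (λ a → Y a ≡ b) as
  All-≗ X≗Y = mapᴬ λ {a} h → trans (sym (X≗Y a)) h

  BodyTrue-≗ : ∀ {X Y} → X ≗ Y → ∀ {b} → BodyTrue X b → BodyTrue Y b
  BodyTrue-≗ X≗Y (ps , ns , bs) = All-≗ X≗Y ps , All-≗ X≗Y ns , bs

  IsModel-resp : ∀ Q → IsModel Q Respects _≗_
  IsModel-resp Q X≗Y (facts⊆ , rules , constraints) =
    (λ a fa → trans (sym (X≗Y a)) (facts⊆ a fa)) ,
    (λ g g∈ true-body → trans (sym (X≗Y (ghead g))) (rules g g∈ (BodyTrue-≗ Y≗X true-body))) ,
    (λ b b∈ true-body → constraints b b∈ (BodyTrue-≗ Y≗X true-body))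
    where Y≗X = λ a → sym (X≗Y a)

  RuleHolds : Interp → Interp → GStd → Set
  RuleHolds R X g = All (_∉I R) (gneg (gbody g)) → BodyTrue X (dropNeg (gbody g)) → ghead g ∈I X

  MappingHolds : Interp → Interp → GMap → Set
  MappingHolds R X m = gmhead m ∈I R → BodyTrue X (gbody (StMap m)) → gmhead m ∈I X

  ConstraintHolds : Interp → Interp → GBody → Set
  ConstraintHolds R X b = All (_∉I R) (gneg b) → ¬ BodyTrue X (dropNeg b)

  StReduct : Program → Interp → GProg
  StReduct P R = St (reduct R (ground P))

  record ReductModel (P : Program) (R X : Interp) : Set where
    field
      facts-hold       : All (_∈I X) (D P)
      rules-hold       : All (λ r → ∀ σ → RuleHolds R X (instStd σ r)) (LP P)
      mappings-hold    : All (λ m → ∀ σ → MappingHolds R X (instMap σ m)) (MP P)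
      constraints-hold : All (λ c → ∀ σ → ConstraintHolds R X (instBody σ (body c))) (IC P)
  open ReductModel

  reductModel⇔ : ∀ P R X → ReductModel P R X ⇔ IsModel (StReduct P R) X
  reductModel⇔ P R X = mk⇔ to from
    where
    to : ReductModel P R X → IsModel (StReduct P R) X
    to M = (λ a a∈ → lookupᴬ (facts-hold M) a∈) , rule , constraint
      where
      rule : ∀ g → std (StReduct P R) g → BodyTrue X (gbody g) → ghead g ∈I X
      rule _ (inj₁ (_ , (r , σ , r∈ , refl) , negs , refl)) = lookupᴬ (rules-hold M) r∈ σ negs
      rule _ (inj₂ (_ , ((m , σ , m∈ , refl) , hd) , refl)) = lookupᴬ (mappings-hold M) m∈ σ hd
      constraint : ∀ b → cons (StReduct P R) b → ¬ BodyTrue X b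
      constraint _ (_ , (c , σ , c∈ , refl) , negs , refl) = lookupᴬ (constraints-hold M) c∈ σ negs
    from : IsModel (StReduct P R) X → ReductModel P R X
    from (facts⊆ , rule , constraint) = record
      { facts-hold       = tabulateᴬ λ {a} a∈ → facts⊆ a a∈
      ; rules-hold       = tabulateᴬ λ {r} r∈ σ negs →
          rule _ (inj₁ (instStd σ r , (r , σ , r∈ , refl) , negs , refl))
      ; mappings-hold    = tabulateᴬ λ {m} m∈ σ hd →
          rule _ (inj₂ (instMap σ m , ((m , σ , m∈ , refl) , hd) , refl))
      ; constraints-hold = tabulateᴬ λ {c} c∈ σ negs →
          constraint _ (instBody σ (body c) , (c , σ , c∈ , refl) , negs , refl)
      }

  reductModel? : ∀ P R X → Dec (ReductModel P R X)
  reductModel? P R X =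
    map′ (λ (fs , rs , ms , cs) → record
            { facts-hold = fs ; rules-hold = rs ; mappings-hold = ms ; constraints-hold = cs })
         (λ M → facts-hold M , rules-hold M , mappings-hold M , constraints-hold M)
         (all? (_∈? X) (D P)
           ×-dec all? (λ r → ∀? substitutions (λ σ≗τ → subst (RuleHolds R X) (instStd-cong σ≗τ r))
                                 λ σ → all? (_∉? R) _ →-dec bodyTrue? X _ →-dec _ ∈? X) (LP P)
           ×-dec all? (λ m → ∀? substitutions (λ σ≗τ → subst (MappingHolds R X) (instMap-cong σ≗τ m))
                                 λ σ → _ ∈? R →-dec bodyTrue? X _ →-dec _ ∈? X) (MP P)
           ×-dec all? (λ c → ∀? substitutions
                                 (λ σ≗τ → subst (ConstraintHolds R X) (instBody-cong σ≗τ (body c)))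
                                 λ σ → all? (_∉? R) _ →-dec ¬? (bodyTrue? X _)) (IC P))

  isModel? : ∀ P R X → Dec (IsModel (StReduct P R) X)
  isModel? P R X = map-⇔ (reductModel⇔ P R X) (reductModel? P R X)

  ReductModel-resp-reduct : ∀ {P R R' X} → R ≗ R' → ReductModel P R X → ReductModel P R' X
  ReductModel-resp-reduct R≗R' M = record
    { facts-hold       = facts-hold M
    ; rules-hold       = mapᴬ (λ holds σ negs → holds σ (All-≗ R'≗R negs)) (rules-hold M)
    ; mappings-hold    = mapᴬ (λ holds σ hd → holds σ (trans (R≗R' _) hd)) (mappings-hold M)
    ; constraints-hold = mapᴬ (λ holds σ negs → holds σ (All-≗ R'≗R negs)) (constraints-hold M)
    }
    where R'≗R = λ a → sym (R≗R' a)

  _∩ᴵ_ : Interp → Interp → Interp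
  (X ∩ᴵ Y) a = X a ∧ Y a

  ∧-true⁻ : ∀ {x y} → x ∧ y ≡ true → x ≡ true × y ≡ true
  ∧-true⁻ {true} refl = refl , refl

  ∧-true⁺ : ∀ {x y} → x ≡ true → y ≡ true → x ∧ y ≡ true
  ∧-true⁺ refl refl = refl

  ∩ᴵ-⊆ˡ : ∀ X Y → (X ∩ᴵ Y) ⊆I X
  ∩ᴵ-⊆ˡ X Y a h = proj₁ (∧-true⁻ h)

  ∩ᴵ-⊆ʳ : ∀ X Y → (X ∩ᴵ Y) ⊆I Y
  ∩ᴵ-⊆ʳ X Y a h = proj₂ (∧-true⁻ {X a} h)

  positiveBody-∩ᴵ : ∀ {X Y} b → BodyTrue (X ∩ᴵ Y) (dropNeg b) →
                    BodyTrue X (dropNeg b) × BodyTrue Y (dropNeg b)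
  positiveBody-∩ᴵ {X} {Y} b (ps , [] , bs) =
    (mapᴬ (∩ᴵ-⊆ˡ X Y _) ps , [] , bs) , (mapᴬ (∩ᴵ-⊆ʳ X Y _) ps , [] , bs)

  ReductModel-∩ᴵ : ∀ {P R X Y} → ReductModel P R X → ReductModel P R Y → ReductModel P R (X ∩ᴵ Y)
  ReductModel-∩ᴵ MX MY = record
    { facts-hold       = zipWith (λ (x , y) → ∧-true⁺ x y) (facts-hold MX , facts-hold MY)
    ; rules-hold       = zipWith (λ {r} (hx , hy) σ negs true-body →
        let bx , by = positiveBody-∩ᴵ (gbody (instStd σ r)) true-body in
        ∧-true⁺ (hx σ negs bx) (hy σ negs by)) (rules-hold MX , rules-hold MY)
    ; mappings-hold    = zipWith (λ {m} (hx , hy) σ hd true-body →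
        let bx , by = positiveBody-∩ᴵ (gbody (StMap (instMap σ m))) true-body in
        ∧-true⁺ (hx σ hd bx) (hy σ hd by)) (mappings-hold MX , mappings-hold MY)
    ; constraints-hold = mapᴬ (λ {c} hx σ negs true-body →
                                hx σ negs (proj₁ (positiveBody-∩ᴵ (instBody σ (body c)) true-body)))
                              (constraints-hold MX)
    }

  minModel⇒uniqueMinModel : ∀ P M → IsMinModel (StReduct P M) M → UniqueMinModel (StReduct P M) M
  minModel⇒uniqueMinModel P M (M-model , M-min) = (M-model , M-min) , λ N (N-model , N-min) →
    let M∩N-model = Equivalence.to (reductModel⇔ P M (M ∩ᴵ N))
                      (ReductModel-∩ᴵ (from M-model) (from N-model)) in
    (λ a a∈N → proj₁ (∧-true⁻ (N-min (M ∩ᴵ N) M∩N-model (∩ᴵ-⊆ʳ M N) a a∈N))) ,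
    (λ a a∈M → ∩ᴵ-⊆ʳ M N a (M-min (M ∩ᴵ N) M∩N-model (∩ᴵ-⊆ˡ M N) a a∈M))
    where
    from : ∀ {X} → IsModel (StReduct P M) X → ReductModel P M X
    from = Equivalence.from (reductModel⇔ P M _)

  isMinModel? : ∀ P M → Dec (IsMinModel (StReduct P M) M)
  isMinModel? P M = isModel? P M M ×-dec ∀? interpretations resp
    (λ N → isModel? P M N →-dec N ⊆? M →-dec M ⊆? N)
    where
    resp : (λ N → IsModel (StReduct P M) N → N ⊆I M → M ⊆I N) Respects _≗_
    resp {N} {N'} N≗N' min N'-model N'⊆M a a∈M =
      trans (sym (N≗N' a)) (min (IsModel-resp (StReduct P M) (λ b → sym (N≗N' b)) N'-model)
                          (λ b b∈N → N'⊆M b (trans (sym (N≗N' b)) b∈N)) a a∈M)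

  isWeakModel? : ∀ PS → Decidable (IsWeakModel PS)
  isWeakModel? PS M = map′ (minModel⇒uniqueMinModel (union PS) M) proj₁ (isMinModel? (union PS) M)

  IsWeakModel-resp : ∀ PS → IsWeakModel PS Respects _≗_
  IsWeakModel-resp PS {M} {M'} M≗M' ((M-model , M-min) , _) =
    minModel⇒uniqueMinModel U M' (M'-model , M'-min)
    where
    U = union PS
    M'≗M = λ a → sym (M≗M' a)
    reduct-≗ : ∀ {R R' X} → R ≗ R' → IsModel (StReduct U R) X → IsModel (StReduct U R') X
    reduct-≗ R≗R' = Equivalence.to (reductModel⇔ U _ _)
                  ∘ ReductModel-resp-reduct R≗R' ∘ Equivalence.from (reductModel⇔ U _ _)
    M'-model = IsModel-resp (StReduct U M') M≗M' (reduct-≗ M≗M' M-model)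
    M'-min : ∀ Z → IsModel (StReduct U M') Z → Z ⊆I M' → M' ⊆I Z
    M'-min Z Z-model Z⊆M' a a∈M' =
      M-min Z (reduct-≗ M'≗M Z-model) (λ b b∈Z → trans (M≗M' b) (Z⊆M' b b∈Z)) a (trans (M≗M' a) a∈M')

  -- Maximal weak models

  isMappingAtom? : ∀ PS → Decidable (IsMappingAtom PS)
  isMappingAtom? PS a =
    any? (λ m → peer (head m) ≟ᶠ gpeer a ×-dec pred (atom (head m)) ≟ᶠ gpred a) (MP (union PS))

  ⊒Max? : ∀ PS M N → Dec (M ⊒Max N within PS)
  ⊒Max? PS M N = ∀? atoms (λ { refl h → h }) λ a → isMappingAtom? PS a →-dec a ∈? N →-dec a ∈? M

  MappingAtomIn : System → Interp → GAtom → Set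
  MappingAtomIn PS M a = IsMappingAtom PS a × a ∈I M

  mappingAtomIn? : ∀ PS M → Decidable (MappingAtomIn PS M)
  mappingAtomIn? PS M a = isMappingAtom? PS a ×-dec a ∈? M

  mappingCount : System → Interp → ℕ
  mappingCount PS M = length (filter (mappingAtomIn? PS M) groundAtoms)

  ⊐Max⇒mappingCount< : ∀ PS {M N} → N ⊐Max M within PS → mappingCount PS M < mappingCount PS N
  ⊐Max⇒mappingCount< PS {M} {N} (N⊒M , M⋣N) = ≰⇒> λ count≤ → M⋣N λ a a-map a∈N →
    proj₂ (filter-length-reflects (mappingAtomIn? PS M) (mappingAtomIn? PS N)
             (λ (a-map , a∈M) → a-map , N⊒M _ a-map a∈M)
             groundAtoms count≤ (∈-groundAtoms a) (a-map , a∈N))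

  weakImprovement? : ∀ PS M → Dec (∃ λ N → IsWeakModel PS N × N ⊐Max M within PS)
  weakImprovement? PS M = ∃? interpretations resp λ N →
    isWeakModel? PS N ×-dec (⊒Max? PS N M ×-dec ¬? (⊒Max? PS M N))
    where
    resp : (λ N → IsWeakModel PS N × N ⊐Max M within PS) Respects _≗_
    resp N≗N' (N-weak , N⊒M , M⋣N) =
      IsWeakModel-resp PS N≗N' N-weak ,
      (λ a a-map a∈M → trans (sym (N≗N' a)) (N⊒M a a-map a∈M)) ,
      (λ M⊒N' → M⋣N λ a a-map a∈N → M⊒N' a a-map (trans (sym (N≗N' a)) a∈N))

  maxWeakModel-exists : ∀ PS → ∃ (IsWeakModel PS) → ∃ (IsMaxWeakModel PS)
  maxWeakModel-exists PS =
    maximal-element (IsWeakModel PS) (λ N M → N ⊐Max M within PS) (mappingCount PS) (length groundAtoms)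
                    (λ M → List.length-filter (mappingAtomIn? PS M) groundAtoms)
                    (⊐Max⇒mappingCount< PS) (weakImprovement? PS)

  -- A weak model glued from local stable models

  IsModel-St⁻ : ∀ Q X → IsModel (St Q) X → IsModel Q X
  IsModel-St⁻ Q X (facts⊆ , rules , constraints) = facts⊆ , (λ g g∈ → rules g (inj₁ g∈)) , constraints

  IsModel-St⁺ : ∀ Q X → (∀ m → ¬ maps Q m) → IsModel Q X → IsModel (St Q) X
  IsModel-St⁺ Q X no-maps (facts⊆ , rules , constraints) = facts⊆ , rules′ , constraints
    where
    rules′ : ∀ g → std (St Q) g → BodyTrue X (gbody g) → ghead g ∈I X
    rules′ g (inj₁ g∈)           = rules g g∈
    rules′ g (inj₂ (m , m∈ , _)) = ⊥-elim (no-maps m m∈)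

  stable⇒reductModel : ∀ {P M} → IsStable (localProgram P) M → ReductModel (localProgram P) M M
  stable⇒reductModel {P} {M} ((M-model , _) , _) =
    Equivalence.from (reductModel⇔ (localProgram P) M M)
      (IsModel-St⁺ _ M (λ { _ ((_ , _ , () , _) , _) }) M-model)

  stable⇒minimal : ∀ {P M N} → IsStable (localProgram P) M →
                   ReductModel (localProgram P) M N → N ⊆I M → M ⊆I N
  stable⇒minimal {P} {M} {N} ((_ , M-min) , _) N-model =
    M-min N (IsModel-St⁻ _ N (Equivalence.to (reductModel⇔ (localProgram P) M N) N-model))

  AgreeOn : PeerId → Interp → Interp → Set
  AgreeOn i X Y = ∀ a → gpeer a ≡ i → X a ≡ Y a

  AgreeOn-sym : ∀ {i X Y} → AgreeOn i X Y → AgreeOn i Y X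
  AgreeOn-sym X≈Y a on-i = sym (X≈Y a on-i)

  agree-∈ : ∀ {i X Y b a} → AgreeOn i X Y → gpeer a ≡ i → X a ≡ b → Y a ≡ b
  agree-∈ X≈Y on-i h = trans (sym (X≈Y _ on-i)) h

  instA-peer : ∀ σ j l → gpeer (instA σ j l) ≡ j
  instA-peer σ j (p ⟨ ts ⟩) = refl

  All-agree : ∀ {i X Y b} → AgreeOn i X Y → ∀ σ ls →
              All (λ a → X a ≡ b) (map (instA σ i) ls) → All (λ a → Y a ≡ b) (map (instA σ i) ls)
  All-agree X≈Y σ []       []       = []
  All-agree X≈Y σ (l ∷ ls) (h ∷ hs) = agree-∈ X≈Y (instA-peer σ _ l) h ∷ All-agree X≈Y σ ls hs

  rule-transfer : ∀ {i R R' X X'} → AgreeOn i R R' → AgreeOn i X X' →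
                  ∀ r → peer (head r) ≡ i → bpeer (StdRule.body r) ≡ i →
                  (∀ σ → RuleHolds R X (instStd σ r)) → ∀ σ → RuleHolds R' X' (instStd σ r)
  rule-transfer R≈R' X≈X' r head-on-i refl holds σ negs (ps , [] , bs) =
    agree-∈ X≈X' (trans (instA-peer σ _ (atom (head r))) head-on-i)
      (holds σ (All-agree (AgreeOn-sym R≈R') σ (neg (StdRule.body r)) negs)
               (All-agree (AgreeOn-sym X≈X') σ (pos (StdRule.body r)) ps , [] , bs))

  constraint-transfer : ∀ {i R R' X X'} → AgreeOn i R R' → AgreeOn i X X' →
                        ∀ c → bpeer (Constraint.body c) ≡ i →
                        (∀ σ → ConstraintHolds R X (instBody σ (Constraint.body c))) →
                        ∀ σ → ConstraintHolds R' X' (instBody σ (Constraint.body c))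
  constraint-transfer R≈R' X≈X' c refl holds σ negs (ps , [] , bs) =
    holds σ (All-agree (AgreeOn-sym R≈R') σ (neg (Constraint.body c)) negs)
            (All-agree (AgreeOn-sym X≈X') σ (pos (Constraint.body c)) ps , [] , bs)

  ReductModel-transfer : ∀ {i P R R' X X'} → WellFormedPeer i P → AgreeOn i R R' → AgreeOn i X X' →
                         ReductModel P R X → ReductModel (localProgram P) R' X'
  ReductModel-transfer (D-on-i , LP-on-i , _ , IC-on-i) R≈R' X≈X' M = record
    { facts-hold       = tabulateᴬ λ a∈ → agree-∈ X≈X' (lookupᴬ D-on-i a∈) (lookupᴬ (facts-hold M) a∈)
    ; rules-hold       = tabulateᴬ λ {r} r∈ → let head-on-i , body-on-i , _ = lookupᴬ LP-on-i r∈ in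
        rule-transfer R≈R' X≈X' r head-on-i body-on-i (lookupᴬ (rules-hold M) r∈)
    ; mappings-hold    = []
    ; constraints-hold = tabulateᴬ λ {c} c∈ →
        constraint-transfer R≈R' X≈X' c (proj₁ (lookupᴬ IC-on-i c∈)) (lookupᴬ (constraints-hold M) c∈)
    }

  WellFormedPeer-local : ∀ {i P} → WellFormedPeer i P → WellFormedPeer i (localProgram P)
  WellFormedPeer-local (D-on-i , LP-on-i , _ , IC-on-i) = D-on-i , LP-on-i , [] , IC-on-i

  All-⋃⁺ : ∀ {A : Set} {P : A → Set} (f : PeerId → List A) →
           (∀ i → All P (f i)) → All P (concatMap f (allFin n))
  All-⋃⁺ f all-f = tabulateᴬ λ x∈ →
    let i , x∈fᵢ = satisfied (∈-concatMap⁻ f {xs = allFin n} x∈) in lookupᴬ (all-f i) x∈fᵢ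

  All-⋃⁻ : ∀ {A : Set} {P : A → Set} (f : PeerId → List A) →
           All P (concatMap f (allFin n)) → ∀ i → All P (f i)
  All-⋃⁻ f all-f i = tabulateᴬ λ x∈ → lookupᴬ all-f (∈-concatMap⁺ f (lose (∈-allFin i) x∈))

  module _ (PS : System) {R X : Interp} where

    ReductModel-⋃ : (∀ i → ReductModel (localProgram (PS i)) R X) →
                    All (λ m → ∀ σ → MappingHolds R X (instMap σ m)) (MP (union PS)) →
                    ReductModel (union PS) R X
    ReductModel-⋃ Ms mappings = record
      { facts-hold       = All-⋃⁺ _ (facts-hold ∘ Ms)
      ; rules-hold       = All-⋃⁺ _ (rules-hold ∘ Ms)
      ; mappings-hold    = mappings
      ; constraints-hold = All-⋃⁺ _ (constraints-hold ∘ Ms)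
      }

    ReductModel-peer : ReductModel (union PS) R X → ∀ i → ReductModel (PS i) R X
    ReductModel-peer M i = record
      { facts-hold       = All-⋃⁻ _ (facts-hold M) i
      ; rules-hold       = All-⋃⁻ _ (rules-hold M) i
      ; mappings-hold    = All-⋃⁻ _ (mappings-hold M) i
      ; constraints-hold = All-⋃⁻ _ (constraints-hold M) i
      }

  patch : PeerId → Interp → Interp → Interp
  patch i X Y a = if does (gpeer a ≟ᶠ i) then X a else Y a

  patch-agree : ∀ i X Y → AgreeOn i X (patch i X Y)
  patch-agree i X Y a on-i with gpeer a ≟ᶠ i
  ... | yes _    = refl
  ... | no off-i = ⊥-elim (off-i on-i)

  patch-⊆ : ∀ i {X Y Z} → AgreeOn i Z Y → X ⊆I Z → patch i X Y ⊆I Y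
  patch-⊆ i Z≈Y X⊆Z a a∈ with gpeer a ≟ᶠ i
  ... | yes on-i = agree-∈ Z≈Y on-i (X⊆Z a a∈)
  ... | no _     = a∈

  weakModel-exists : ∀ PS → (∀ i → WellFormedPeer i (PS i)) → LocallyConsistent PS → ∃ (IsWeakModel PS)
  weakModel-exists PS wf lc =
    glued , minModel⇒uniqueMinModel (union PS) glued
              (Equivalence.to (reductModel⇔ _ _ _) glued-model , glued-minimal)
    where
    local : PeerId → Interp
    local i = proj₁ (lc i)

    glued : Interp
    glued a = local (gpeer a) a

    local≈glued : ∀ i → AgreeOn i (local i) glued
    local≈glued i a refl = refl

    glued-model : ReductModel (union PS) glued glued
    glued-model = ReductModel-⋃ PS
      (λ i → ReductModel-transfer (WellFormedPeer-local (wf i)) (local≈glued i) (local≈glued i)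
                                  (stable⇒reductModel {PS i} (proj₂ (lc i))))
      (tabulateᴬ λ _ σ head∈glued _ → head∈glued)

    glued-minimal : ∀ N → IsModel (StReduct (union PS) glued) N → N ⊆I glued → glued ⊆I N
    glued-minimal N N-model N⊆glued a a∈glued =
      agree-∈ (AgreeOn-sym (patch-agree i N (local i))) refl
        (stable⇒minimal {PS i} (proj₂ (lc i)) Nᵢ-model
                        (patch-⊆ i (AgreeOn-sym (local≈glued i)) N⊆glued)
                        a (agree-∈ (AgreeOn-sym (local≈glued i)) refl a∈glued))
      where
      i = gpeer a
      Nᵢ-model : ReductModel (localProgram (PS i)) (local i) (patch i N (local i))
      Nᵢ-model = ReductModel-transfer (wf i) (AgreeOn-sym (local≈glued i)) (patch-agree i N (local i))
                   (ReductModel-peer PS (Equivalence.from (reductModel⇔ _ _ _) N-model) i)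

open Defs

mainTheorem3 : (S : Sig) (n : ℕ) (PS : System S n)
    → WellFormedSystem S n PS
    → LocallyConsistent S n PS
    → MaximalSystem S n PS
    → ∃ λ M → IsMaxWeakModel S n PS M
mainTheorem3 S n PS (wf , _) lc _ = maxWeakModel-exists S n PS (weakModel-exists S n PS wf lc)
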